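{- For every $k \geq 1$ and $n \geq 1$, the star-chromatic number of the power of a path $P_n^k$ equals its biclique-chromatic number.
   Context: For $k \geq 1$, the power of a path $P_n^k$ is the simple graph with vertex set $\{v_0,\dots,v_{n-1}\}$ in which $v_i v_j$ is an edge if and only if $0<|i-j| \leq k$. A biclique of a graph is a maximal (under inclusion) set of vertices inducing a complete bipartite subgraph with at least one edge. A star is a maximal (under inclusion) set of vertices inducing a complete bipartite subgraph that has a universal vertex (adjacent to all others in the set) and at least one edge. A biclique-colouring (resp. star-colouring) is an assignment of colours to vertices such that no biclique (resp. no star) is monochromatic; the biclique-chromatic number (resp. star-chromatic number) is the least $c$ such that such a colouring with at most $c$ colours exists. -}

module Defs where

open import Data.Nat using (ℕ; _≤_; _<_; _+_)
open import Data.Fin using (Fin; toℕ)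
open import Data.Fin.Subset using (Subset; _∈_; _⊆_)
open import Data.Product using (Σ; ∃; _×_; Σ-syntax; ∃-syntax)
open import Data.Sum using (_⊎_)
open import Data.Empty using (⊥)
open import Relation.Nullary using (¬_)
open import Relation.Binary.PropositionalEquality using (_≡_; _≢_)

Graph : ℕ → Set₁
Graph n = Fin n → Fin n → Set

PathPower : (n k : ℕ) → Graph n
PathPower n k i j = (i ≢ j) × (toℕ i ≤ toℕ j + k) × (toℕ j ≤ toℕ i + k)

module _ {n : ℕ} (G : Graph n) where

  InducesCompleteBipartite : Subset n → Set
  InducesCompleteBipartite S =
    Σ[ A ∈ Subset n ] Σ[ B ∈ Subset n ]
      (∀ x → (x ∈ S → (x ∈ A ⊎ x ∈ B)) × ((x ∈ A ⊎ x ∈ B) → x ∈ S))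
    × (∀ x → x ∈ A → x ∈ B → ⊥)
    × (∀ x y → x ∈ A → y ∈ A → ¬ G x y)
    × (∀ x y → x ∈ B → y ∈ B → ¬ G x y)
    × (∀ x y → x ∈ A → y ∈ B → G x y)
    × (∃[ x ] ∃[ y ] (x ∈ S × y ∈ S × G x y))

  InducesStarGraph : Subset n → Set
  InducesStarGraph S =
    InducesCompleteBipartite S
    × (∃[ v ] (v ∈ S × (∀ x → x ∈ S → x ≢ v → G v x)))

  Maximal : (Subset n → Set) → Subset n → Set
  Maximal P S = P S × (∀ T → S ⊆ T → P T → T ⊆ S)

  IsBiclique : Subset n → Set
  IsBiclique = Maximal InducesCompleteBipartite

  IsStar : Subset n → Set
  IsStar = Maximal InducesStarGraph

  Colouring : ℕ → Set
  Colouring m = Fin n → Fin m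

  Monochromatic : {m : ℕ} → Colouring m → Subset n → Set
  Monochromatic c S = ∀ x y → x ∈ S → y ∈ S → c x ≡ c y

  IsBicliqueColouring : {m : ℕ} → Colouring m → Set
  IsBicliqueColouring c = ∀ S → IsBiclique S → ¬ Monochromatic c S

  IsStarColouring : {m : ℕ} → Colouring m → Set
  IsStarColouring c = ∀ S → IsStar S → ¬ Monochromatic c S

  IsLeastColours : ({m : ℕ} → Colouring m → Set) → ℕ → Set
  IsLeastColours Valid χ =
    (Σ[ c ∈ Colouring χ ] Valid c)
    × (∀ m → m < χ → ¬ (Σ[ c ∈ Colouring m ] Valid c))

  IsBicliqueChromaticNumber : ℕ → Set
  IsBicliqueChromaticNumber = IsLeastColours IsBicliqueColouring

  IsStarChromaticNumber : ℕ → Set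
  IsStarChromaticNumber = IsLeastColours IsStarColouring

-- In a power of a path, two non-adjacent vertices lie more than k apart, so any two common
-- neighbours of them lie within k of each other and are adjacent: P_n^k has no induced C₄.
-- In a graph without induced C₄ a complete bipartite subgraph cannot have two vertices on
-- each side, so one side is a single vertex adjacent to everything else; hence the sets
-- inducing complete bipartite graphs, their maximal members, and finally the two kinds of
-- colourings all coincide. Both chromatic numbers are then the least number of colours of a
-- biclique-colouring, which exists because validity is decidable and n colours suffice.
module Submission where

open import Defs
open import Data.Nat using (ℕ; _≥_; zero; suc; _+_; _≤_; _<_; _≤?_)
open import Data.Nat.Properties using (≤-trans; <⇒≤; <-≤-trans; ≰⇒>; ≤-refl; m<1+n⇒m<n∨m≡n)
open import Data.Product using (Σ-syntax; ∃-syntax; _×_; ∃; _,_; proj₁; proj₂)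
open import Data.Sum using (_⊎_; inj₁; inj₂; swap)
open import Data.Empty using (⊥; ⊥-elim)
open import Data.Fin using (Fin; toℕ; _≟_) renaming (zero to fzero; suc to fsuc)
open import Data.Fin.Subset using (Subset; _∈_)
open import Data.Fin.Subset.Properties using (_∈?_; _⊆?_; anySubset?)
open import Data.Fin.Properties using (any?; all?; ∀-cons)
open import Relation.Binary.Definitions using (Symmetric; Irreflexive; Decidable)
open import Relation.Nullary using (¬_; Dec; yes; no)
open import Relation.Nullary.Decidable using (_×-dec_; _→-dec_; _⊎-dec_; ¬?; decidable-stable)
open import Relation.Binary.PropositionalEquality using (_≡_; _≢_; refl; sym; trans)
open import Function using (_∘′_)

private
  variable
    n : ℕ

NoInducedC₄ : Graph n → Set
NoInducedC₄ G = ∀ {a a′ b b′} → a ≢ a′ → b ≢ b′ → ¬ G a a′ → ¬ G b b′ →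
  G a b → G a b′ → G a′ b → G a′ b′ → ⊥

module _ {G : Graph n} (G-sym : Symmetric G) (noC₄ : NoInducedC₄ G) where

  private
    aloneInPart⇒universal : ∀ {S A B a} → (∀ z → z ∈ S → z ∈ A ⊎ z ∈ B) →
      (∀ z → z ∈ B → G a z) → ¬ (∃[ z ] (z ∈ A × z ≢ a)) →
      ∀ z → z ∈ S → z ≢ a → G a z
    aloneInPart⇒universal split a-B alone z z∈S z≢a with split z z∈S
    ... | inj₁ z∈A = ⊥-elim (alone (z , z∈A , z≢a))
    ... | inj₂ z∈B = a-B z z∈B

  completeBipartite⇒star : ∀ S → InducesCompleteBipartite G S → InducesStarGraph G S
  completeBipartite⇒star S
    cb@(A , B , part , _ , indA , indB , complete , x , y , x∈S , y∈S , xy) =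
    cb , universal (split x x∈S) (split y y∈S) xy
    where
    split : ∀ z → z ∈ S → z ∈ A ⊎ z ∈ B
    split z = proj₁ (part z)

    UniversalVertex : Set
    UniversalVertex = ∃[ v ] (v ∈ S × (∀ z → z ∈ S → z ≢ v → G v z))

    universalFromEdge : ∀ {a b} → a ∈ A → b ∈ B → UniversalVertex
    universalFromEdge {a} {b} a∈A b∈B with any? (λ z → (z ∈? A) ×-dec ¬? (z ≟ a))
    ... | no aloneA = a , proj₂ (part a) (inj₁ a∈A) ,
          aloneInPart⇒universal split (λ z → complete a z a∈A) aloneA
    ... | yes (a′ , a′∈A , a′≢a) with any? (λ z → (z ∈? B) ×-dec ¬? (z ≟ b))
    ...   | no aloneB = b , proj₂ (part b) (inj₂ b∈B) ,
            aloneInPart⇒universal (λ z → swap ∘′ split z)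
              (λ z z∈A → G-sym (complete z b z∈A b∈B)) aloneB
    ...   | yes (b′ , b′∈B , b′≢b) = ⊥-elim (noC₄ (a′≢a ∘′ sym) (b′≢b ∘′ sym)
            (indA a a′ a∈A a′∈A) (indB b b′ b∈B b′∈B)
            (complete a b a∈A b∈B) (complete a b′ a∈A b′∈B)
            (complete a′ b a′∈A b∈B) (complete a′ b′ a′∈A b′∈B))

    universal : x ∈ A ⊎ x ∈ B → y ∈ A ⊎ y ∈ B → G x y → UniversalVertex
    universal (inj₁ x∈A) (inj₁ y∈A) xy = ⊥-elim (indA x y x∈A y∈A xy)
    universal (inj₁ x∈A) (inj₂ y∈B) _  = universalFromEdge x∈A y∈B
    universal (inj₂ x∈B) (inj₁ y∈A) _  = universalFromEdge y∈A x∈B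
    universal (inj₂ x∈B) (inj₂ y∈B) xy = ⊥-elim (indB x y x∈B y∈B xy)

module _ {G : Graph n} (cb⇒star : ∀ S → InducesCompleteBipartite G S → InducesStarGraph G S) where

  biclique⇒star : ∀ {S} → IsBiclique G S → IsStar G S
  biclique⇒star {S} (cb , maximal) = cb⇒star S cb , λ T S⊆T → maximal T S⊆T ∘′ proj₁

  star⇒biclique : ∀ {S} → IsStar G S → IsBiclique G S
  star⇒biclique (star , maximal) = proj₁ star , λ T S⊆T → maximal T S⊆T ∘′ cb⇒star T

  bicliqueColouring⇒starColouring : ∀ {m} {c : Colouring G m} →
    IsBicliqueColouring G c → IsStarColouring G c
  bicliqueColouring⇒starColouring valid S = valid S ∘′ star⇒biclique

  starColouring⇒bicliqueColouring : ∀ {m} {c : Colouring G m} →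
    IsStarColouring G c → IsBicliqueColouring G c
  starColouring⇒bicliqueColouring valid S = valid S ∘′ biclique⇒star

IsLeastColours-cong : {G : Graph n} {V W : {m : ℕ} → Colouring G m → Set} {χ : ℕ} →
  (∀ {m} {c : Colouring G m} → V c → W c) → (∀ {m} {c : Colouring G m} → W c → V c) →
  IsLeastColours G V χ → IsLeastColours G W χ
IsLeastColours-cong V⇒W W⇒V ((c , v) , least) =
  (c , V⇒W v) , λ m m<χ (c′ , w) → least m m<χ (c′ , W⇒V w)

leastBelow : {P : ℕ → Set} → (∀ m → Dec (P m)) → ∀ N →
  (∃[ χ ] (P χ × (∀ m → m < χ → ¬ P m))) ⊎ (∀ m → m < N → ¬ P m)
leastBelow P? zero = inj₂ λ _ ()
leastBelow P? (suc N) with leastBelow P? N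
... | inj₁ least = inj₁ least
... | inj₂ none with P? N
...   | yes p  = inj₁ (N , p , none)
...   | no ¬p = inj₂ λ m m<1+N → below (m<1+n⇒m<n∨m≡n m<1+N)
  where
  below : ∀ {m} → m < N ⊎ m ≡ N → ¬ _
  below (inj₁ m<N) = none _ m<N
  below (inj₂ refl) = ¬p

leastWitness : {P : ℕ → Set} → (∀ m → Dec (P m)) → ∀ N → P N →
  ∃[ χ ] (P χ × (∀ m → m < χ → ¬ P m))
leastWitness P? N p with leastBelow P? (suc N)
... | inj₁ least = least
... | inj₂ none = ⊥-elim (none N ≤-refl p)

allSubset? : {P : Subset n → Set} → (∀ S → Dec (P S)) → Dec (∀ S → P S)
allSubset? P? with anySubset? (λ S → ¬? (P? S))
... | yes (S , ¬p) = no λ all → ¬p (all S)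
... | no ¬some = yes λ S → decidable-stable (P? S) (λ ¬p → ¬some (S , ¬p))

anyFunction? : ∀ n {m} {P : (Fin n → Fin m) → Set} →
  (∀ {f g} → (∀ x → f x ≡ g x) → P f → P g) →
  (∀ f → Dec (P f)) → Dec (∃ P)
anyFunction? zero P-resp P? with P? (λ ())
... | yes p = yes (_ , p)
... | no ¬p = no λ (f , pf) → ¬p (P-resp (λ ()) pf)
anyFunction? (suc n) P-resp P? with any? (λ i →
    anyFunction? n (λ f≗g → P-resp (∀-cons refl f≗g)) (λ f → P? (∀-cons i f)))
... | yes (i , f , p) = yes (∀-cons i f , p)
... | no ¬some = no λ (f , pf) →
    ¬some (f fzero , f ∘′ fsuc , P-resp (∀-cons refl (λ _ → refl)) pf)

module _ {G : Graph n} (G? : Decidable G) where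

  completeBipartite? : ∀ S → Dec (InducesCompleteBipartite G S)
  completeBipartite? S = anySubset? λ A → anySubset? λ B →
       all? (λ x → ((x ∈? S) →-dec ((x ∈? A) ⊎-dec (x ∈? B)))
                   ×-dec (((x ∈? A) ⊎-dec (x ∈? B)) →-dec (x ∈? S)))
    ×-dec all? (λ x → (x ∈? A) →-dec ((x ∈? B) →-dec no λ ()))
    ×-dec all? (λ x → all? λ y → (x ∈? A) →-dec ((y ∈? A) →-dec ¬? (G? x y)))
    ×-dec all? (λ x → all? λ y → (x ∈? B) →-dec ((y ∈? B) →-dec ¬? (G? x y)))
    ×-dec all? (λ x → all? λ y → (x ∈? A) →-dec ((y ∈? B) →-dec G? x y))
    ×-dec any? (λ x → any? λ y → (x ∈? S) ×-dec (y ∈? S) ×-dec G? x y)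

  biclique? : ∀ S → Dec (IsBiclique G S)
  biclique? S = completeBipartite? S
    ×-dec allSubset? (λ T → (S ⊆? T) →-dec (completeBipartite? T →-dec (T ⊆? S)))

  monochromatic? : ∀ {m} (c : Colouring G m) S → Dec (Monochromatic G c S)
  monochromatic? c S = all? λ x → all? λ y → (x ∈? S) →-dec ((y ∈? S) →-dec (c x ≟ c y))

  bicliqueColouring? : ∀ {m} (c : Colouring G m) → Dec (IsBicliqueColouring G c)
  bicliqueColouring? c = allSubset? λ S → biclique? S →-dec ¬? (monochromatic? c S)

  bicliqueColouring-resp : ∀ {m} {c d : Colouring G m} → (∀ x → c x ≡ d x) →
    IsBicliqueColouring G c → IsBicliqueColouring G d
  bicliqueColouring-resp c≗d valid S isBiclique mono = valid S isBiclique
    λ x y x∈S y∈S → trans (c≗d x) (trans (mono x y x∈S y∈S) (sym (c≗d y)))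

  identity-bicliqueColouring : Irreflexive _≡_ G → IsBicliqueColouring G (λ x → x)
  identity-bicliqueColouring irrefl S (cb , _) mono =
    let (_ , _ , _ , _ , _ , _ , _ , x , y , x∈S , y∈S , xy) = cb
    in irrefl (mono x y x∈S y∈S) xy

  bicliqueChromaticNumber-exists : Irreflexive _≡_ G → ∃ (IsBicliqueChromaticNumber G)
  bicliqueChromaticNumber-exists irrefl =
    leastWitness (λ m → anyFunction? n bicliqueColouring-resp bicliqueColouring?) n
      (_ , identity-bicliqueColouring irrefl)

module _ {k : ℕ} where

  pathPower? : Decidable (PathPower n k)
  pathPower? i j = ¬? (i ≟ j) ×-dec (toℕ i ≤? toℕ j + k) ×-dec (toℕ j ≤? toℕ i + k)

  pathPower-sym : Symmetric (PathPower n k)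
  pathPower-sym (i≢j , i≤j+k , j≤i+k) = i≢j ∘′ sym , j≤i+k , i≤j+k

  pathPower-irrefl : Irreflexive _≡_ (PathPower n k)
  pathPower-irrefl i≡j (i≢j , _) = i≢j i≡j

  nonAdjacent⇒farApart : ∀ {i j : Fin n} → i ≢ j → ¬ PathPower n k i j →
    toℕ i + k < toℕ j ⊎ toℕ j + k < toℕ i
  nonAdjacent⇒farApart {i = i} {j} i≢j ¬ij with toℕ i ≤? toℕ j + k | toℕ j ≤? toℕ i + k
  ... | yes i≤j+k | yes j≤i+k = ⊥-elim (¬ij (i≢j , i≤j+k , j≤i+k))
  ... | yes _     | no j≰i+k  = inj₁ (≰⇒> j≰i+k)
  ... | no i≰j+k  | _         = inj₂ (≰⇒> i≰j+k)

  neighboursAcrossGap-near : ∀ {a a′ b b′ : Fin n} → toℕ a + k < toℕ a′ →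
    PathPower n k a b → PathPower n k a′ b′ → toℕ b ≤ toℕ b′ + k
  neighboursAcrossGap-near a+k<a′ (_ , _ , b≤a+k) (_ , a′≤b′+k , _) =
    ≤-trans b≤a+k (<⇒≤ (<-≤-trans a+k<a′ a′≤b′+k))

  pathPower-noInducedC₄ : NoInducedC₄ (PathPower n k)
  pathPower-noInducedC₄ a≢a′ b≢b′ ¬aa′ ¬bb′ ab ab′ a′b a′b′ with nonAdjacent⇒farApart a≢a′ ¬aa′
  ... | inj₁ gap = ¬bb′ (b≢b′ , neighboursAcrossGap-near gap ab a′b′ ,
                              neighboursAcrossGap-near gap ab′ a′b)
  ... | inj₂ gap = ¬bb′ (b≢b′ , neighboursAcrossGap-near gap a′b ab′ ,
                              neighboursAcrossGap-near gap a′b′ ab)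

theorem9 : (k n : ℕ) → k ≥ 1 → n ≥ 1 →
    Σ[ χ ∈ ℕ ] (IsStarChromaticNumber (PathPower n k) χ
    × IsBicliqueChromaticNumber (PathPower n k) χ)
theorem9 k n _ _ =
  let χ , isBicliqueChromatic = bicliqueChromatic
  in χ , IsLeastColours-cong {G = PathPower n k}
           (bicliqueColouring⇒starColouring cb⇒star)
           (starColouring⇒bicliqueColouring cb⇒star) isBicliqueChromatic
       , isBicliqueChromatic
  where
  bicliqueChromatic : ∃ (IsBicliqueChromaticNumber (PathPower n k))
  bicliqueChromatic = bicliqueChromaticNumber-exists pathPower? pathPower-irrefl

  cb⇒star : ∀ S → InducesCompleteBipartite (PathPower n k) S → InducesStarGraph (PathPower n k) S
  cb⇒star = completeBipartite⇒star pathPower-sym pathPower-noInducedC₄
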